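{- For every digraph $X$, the Redei-Berge symmetric functions of $X$ and of its opposite digraph $X^{\mathrm{op}}$ coincide: $U_{X^{\mathrm{op}}}=U_X$.
   Context: A digraph is a pair $X=(V,E)$ with $V$ finite and $E\subset\{(u,v)\in V\times V\mid u\ne v\}$; $n=|V|$. The opposite digraph is $X^{\mathrm{op}}=(V,E^{\mathrm{op}})$ with $(u,v)\in E^{\mathrm{op}}$ iff $(v,u)\in E$. A $V$-listing is a bijection $\sigma:[n]\to V$; $\Sigma_V$ is the set of $V$-listings; $X\mathrm{Des}(\sigma)=\{1\le i\le n-1\mid(\sigma_i,\sigma_{i+1})\in E\}$. For $I\subset[n-1]$, $F_I=\sum x_{i_1}\cdots x_{i_n}$ over $1\le i_1\le\cdots\le i_n$ with $i_j<i_{j+1}$ for $j\in I$. The Redei-Berge symmetric function is $U_X=\sum_{\sigma\in\Sigma_V}F_{X\mathrm{Des}(\sigma)}$. -}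

module Defs where

open import Data.Nat using (ℕ; zero; suc; _≡ᵇ_; _<ᵇ_; _≤ᵇ_; _≤_)
open import Data.Bool using (Bool; true; false; _∧_; _∨_; not; if_then_else_)
open import Data.Fin using (Fin)
import Data.Fin.Properties as FinP
open import Data.List using (List; []; _∷_; length; map; concatMap; filter; allFin)
open import Data.Nat.ListAction using (sum)
import Data.List.Relation.Unary.Unique.DecPropositional as UDec
open import Relation.Nullary.Decidable using (⌊_⌋)
open import Relation.Binary.PropositionalEquality using (_≡_)

-- A digraph on the vertex set V = Fin n (any finite V is in bijection with some Fin n).
-- E u v = true means (u , v) ∈ E; loops are excluded.
record Digraph (n : ℕ) : Set where
  field
    E      : Fin n → Fin n → Bool
    irrefl : ∀ v → E v v ≡ false
open Digraph public

op : ∀ {n} → Digraph n → Digraph n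
op X = record { E = λ u v → E X v u ; irrefl = irrefl X }

allLists : (n k : ℕ) → List (List (Fin n))
allLists n zero    = [] ∷ []
allLists n (suc k) = concatMap (λ xs → map (_∷ xs) (allFin n)) (allLists n k)

-- V-listings: bijections [n] → V, represented as duplicate-free lists σ₁ … σₙ
-- of length n over V = Fin n (these are exactly the bijections).
listings : (n : ℕ) → List (List (Fin n))
listings n = filter (λ σ → UDec.unique? (FinP._≟_ {n}) σ) (allLists n n)

-- X-descent set of a listing, as its indicator list (b₁ , … , b_{n-1}),
-- b_i = true iff (σ_i , σ_{i+1}) ∈ E.
XDes : ∀ {n} → Digraph n → List (Fin n) → List Bool
XDes X (u ∷ v ∷ rest) = E X u v ∷ XDes X (v ∷ rest)
XDes X _              = []

compatible : List Bool → List ℕ → Bool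
compatible (b ∷ bs) (a ∷ c ∷ ws) = (a ≤ᵇ c) ∧ (not b ∨ (a <ᵇ c)) ∧ compatible bs (c ∷ ws)
compatible []       (a ∷ c ∷ ws) = false
compatible _        _            = true

-- Coefficient of the monomial x_{w₁} x_{w₂} ⋯ x_{w_k} (w weakly increasing list of
-- variable indices, i.e. a monomial written in canonical order) in the fundamental
-- quasisymmetric function F_I of degree n.
Fcoef : ℕ → List Bool → List ℕ → ℕ
Fcoef n I w = if (length w ≡ᵇ n) ∧ compatible I w then 1 else 0

-- Coefficient of the monomial w in the Redei-Berge function U_X = Σ_σ F_{XDes(σ)}.
Ucoef : ∀ {n} → Digraph n → List ℕ → ℕ
Ucoef {n} X w = sum (map (λ σ → Fcoef n (XDes X σ) w) (listings n))

{-# OPTIONS --safe #-}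
-- Fix a weakly increasing word w of length n and cut it into maximal runs of equal letters.
-- A listing σ contributes x_w to F_{XDes σ} iff no two adjacent positions inside one run
-- carry an edge of X.  Reversing σ on each run turns this condition for X^op into the same
-- condition for X, and block-wise reversal permutes the words of length n and preserves
-- duplicate-freeness, so both coefficients count the same number of listings.
module Submission where

open import Defs
open import Algebra.Properties.CommutativeSemigroup using (interchange)
open import Data.Bool using (Bool; true; false; _∧_; _∨_; not; if_then_else_)
open import Data.Bool.Properties using (T-≡; ∧-assoc; ∧-comm; ∧-identityʳ; ∨-zeroʳ; ∨-identityʳ)
open import Data.Fin using (Fin)
import Data.Fin.Properties as FinP
open import Data.List using (List; []; _∷_; [_]; _++_; _ʳ++_; length; map; concatMap; filter; allFin; reverse; take; drop; replicate)
open import Data.List.Properties using (map-++; map-∘; map-cong; map-cong-local; length-++; length-replicate; length-reverse; unfold-reverse; take++drop≡id)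
open import Data.List.Relation.Unary.All as All using (All)
open import Data.List.Relation.Unary.All.Properties using (concat⁺; map⁺; filter⁺)
open import Data.List.Relation.Unary.Linked using (Linked; _∷_)
open import Data.List.Relation.Binary.Permutation.Propositional using (_↭_; ↭-refl; ↭-sym; ↭⇒↭ₛ)
open import Data.List.Relation.Binary.Permutation.Propositional.Properties using (↭-reverse; ++⁺; ↭-length)
import Data.List.Relation.Binary.Permutation.Setoid.Properties as PermutationSetoid
import Data.List.Relation.Unary.Unique.DecPropositional as UniqueDec
open import Data.Nat using (ℕ; zero; suc; _+_; _≤_; _≡ᵇ_; _<ᵇ_; s≤s)
open import Data.Nat.Properties using (+-identityʳ; +-comm; +-commutativeSemigroup; suc-injective; ≡ᵇ⇒≡; ≡⇒≡ᵇ; ≤⇒≤ᵇ)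
open import Data.Nat.ListAction using (sum)
open import Data.Nat.ListAction.Properties using (sum-++)
open import Data.Product using (_×_; _,_; proj₁; proj₂; map₁)
open import Data.Unit using (⊤; tt)
open import Function using (_∘_)
open import Function.Bundles using (Equivalence; mk⇔)
open import Relation.Nullary.Decidable using (Dec; does; yes; no; does-⇔)
open import Relation.Binary.PropositionalEquality using (_≡_; refl; sym; trans; cong; cong₂; subst; setoid; module ≡-Reasoning)

open ≡-Reasoning

module _ {A : Set} where

  take-length-++ : (xs ys : List A) → take (length xs) (xs ++ ys) ≡ xs
  take-length-++ []       ys = refl
  take-length-++ (x ∷ xs) ys = cong (x ∷_) (take-length-++ xs ys)

  drop-length-++ : (xs ys : List A) → drop (length xs) (xs ++ ys) ≡ ys
  drop-length-++ []       ys = refl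
  drop-length-++ (x ∷ xs) ys = drop-length-++ xs ys

  length-replicate-++ : ∀ r (a : A) xs → length (replicate r a ++ xs) ≡ r + length xs
  length-replicate-++ r a xs = trans (length-++ (replicate r a)) (cong (_+ length xs) (length-replicate r))

  length-take-drop : ∀ k {m} (xs : List A) → length xs ≡ k + m →
    length (take k xs) ≡ k × length (drop k xs) ≡ m
  length-take-drop zero    xs       |xs| = refl , |xs|
  length-take-drop (suc k) (x ∷ xs) |xs| = map₁ (cong suc) (length-take-drop k xs (suc-injective |xs|))

  sum-map-zero : (xs : List A) → sum (map (λ _ → 0) xs) ≡ 0
  sum-map-zero []       = refl
  sum-map-zero (_ ∷ xs) = sum-map-zero xs

  sum-map-+ : (f g : A → ℕ) (xs : List A) →
    sum (map (λ x → f x + g x) xs) ≡ sum (map f xs) + sum (map g xs)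
  sum-map-+ f g []       = refl
  sum-map-+ f g (x ∷ xs) =
    trans (cong (f x + g x +_) (sum-map-+ f g xs)) (interchange +-commutativeSemigroup (f x) (g x) _ _)

  sum-map-filter : {P : A → Set} (P? : ∀ x → Dec (P x)) (f : A → ℕ) (xs : List A) →
    sum (map f (filter P? xs)) ≡ sum (map (λ x → if does (P? x) then f x else 0) xs)
  sum-map-filter P? f []       = refl
  sum-map-filter P? f (x ∷ xs) with P? x
  ... | yes _ = cong (f x +_) (sum-map-filter P? f xs)
  ... | no  _ = sum-map-filter P? f xs

sum-map-comm : {A B : Set} (F : A → B → ℕ) (xs : List A) (ys : List B) →
  sum (map (λ x → sum (map (F x) ys)) xs) ≡ sum (map (λ y → sum (map (λ x → F x y) xs)) ys)
sum-map-comm F []       ys = sym (sum-map-zero ys)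
sum-map-comm F (x ∷ xs) ys =
  trans (cong (sum (map (F x) ys) +_) (sum-map-comm F xs ys)) (sym (sum-map-+ (F x) _ ys))

sum-map-concatMap : {A B : Set} (g : B → ℕ) (f : A → List B) (xs : List A) →
  sum (map g (concatMap f xs)) ≡ sum (map (λ x → sum (map g (f x))) xs)
sum-map-concatMap g f []       = refl
sum-map-concatMap g f (x ∷ xs) = begin
  sum (map g (f x ++ concatMap f xs))              ≡⟨ cong sum (map-++ g (f x) _) ⟩
  sum (map g (f x) ++ map g (concatMap f xs))      ≡⟨ sum-++ (map g (f x)) _ ⟩
  sum (map g (f x)) + sum (map g (concatMap f xs)) ≡⟨ cong (sum (map g (f x)) +_) (sum-map-concatMap g f xs) ⟩
  sum (map g (f x)) + sum (map (λ x → sum (map g (f x))) xs) ∎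

module _ (n : ℕ) where

  Σ-Fin : (Fin n → ℕ) → ℕ
  Σ-Fin h = sum (map h (allFin n))

  Σ-words : ℕ → (List (Fin n) → ℕ) → ℕ
  Σ-words k g = sum (map g (allLists n k))

  allLists-length : ∀ k → All (λ xs → length xs ≡ k) (allLists n k)
  allLists-length zero    = refl All.∷ All.[]
  allLists-length (suc k) =
    concat⁺ (map⁺ (All.map (λ |xs| → map⁺ (All.universal (λ _ → cong suc |xs|) (allFin n))) (allLists-length k)))

  listings-length : All (λ σ → length σ ≡ n) (listings n)
  listings-length = filter⁺ _ (allLists-length n)

  Σ-words-cong : ∀ k {f g : List (Fin n) → ℕ} → (∀ {xs} → length xs ≡ k → f xs ≡ g xs) →
    Σ-words k f ≡ Σ-words k g
  Σ-words-cong k f≗g = cong sum (map-cong-local (All.map f≗g (allLists-length k)))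

  Σ-words-suc : ∀ k g → Σ-words (suc k) g ≡ Σ-words k (λ xs → Σ-Fin (λ x → g (x ∷ xs)))
  Σ-words-suc k g = trans (sum-map-concatMap g _ (allLists n k))
    (cong sum (map-cong (λ xs → cong sum (sym (map-∘ (allFin n)))) (allLists n k)))

  Σ-words-++ : ∀ a b g → Σ-words (a + b) g ≡ Σ-words b (λ ys → Σ-words a (λ xs → g (xs ++ ys)))
  Σ-words-++ zero    b g = Σ-words-cong b (λ {ys} _ → sym (+-identityʳ (g ys)))
  Σ-words-++ (suc a) b g = begin
    Σ-words (suc a + b) g
      ≡⟨ Σ-words-suc (a + b) g ⟩
    Σ-words (a + b) (λ zs → Σ-Fin (λ x → g (x ∷ zs)))
      ≡⟨ Σ-words-++ a b _ ⟩
    Σ-words b (λ ys → Σ-words a (λ xs → Σ-Fin (λ x → g (x ∷ xs ++ ys))))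
      ≡⟨ Σ-words-cong b (λ {ys} _ → sym (Σ-words-suc a (λ xs → g (xs ++ ys)))) ⟩
    Σ-words b (λ ys → Σ-words (suc a) (λ xs → g (xs ++ ys))) ∎

  Σ-words-reverse : ∀ k g → Σ-words k (g ∘ reverse) ≡ Σ-words k g
  Σ-words-reverse zero    g = refl
  Σ-words-reverse (suc k) g = begin
    Σ-words (suc k) (g ∘ reverse)
      ≡⟨ Σ-words-suc k _ ⟩
    Σ-words k (λ xs → Σ-Fin (λ x → g (reverse (x ∷ xs))))
      ≡⟨ Σ-words-cong k (λ {xs} _ → cong sum (map-cong (λ x → cong g (unfold-reverse x xs)) (allFin n))) ⟩
    Σ-words k (λ xs → Σ-Fin (λ x → g (reverse xs ++ [ x ])))
      ≡⟨ Σ-words-reverse k (λ ys → Σ-Fin (λ x → g (ys ++ [ x ]))) ⟩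
    Σ-words k (λ ys → Σ-Fin (λ x → g (ys ++ [ x ])))
      ≡⟨ sum-map-comm (λ ys x → g (ys ++ [ x ])) (allLists n k) (allFin n) ⟩
    Σ-Fin (λ x → Σ-words k (λ ys → g (ys ++ [ x ])))
      ≡⟨ sym (trans (Σ-words-suc 0 _) (+-identityʳ _)) ⟩
    Σ-words 1 (λ zs → Σ-words k (λ ys → g (ys ++ zs)))
      ≡⟨ sym (Σ-words-++ k 1 g) ⟩
    Σ-words (k + 1) g
      ≡⟨ cong (λ k → Σ-words k g) (+-comm k 1) ⟩
    Σ-words (suc k) g ∎

DiffersFromHead : ℕ → List ℕ → Set
DiffersFromHead a []      = ⊤
DiffersFromHead a (c ∷ _) = (a ≡ᵇ c) ≡ false

data Runs : List ℕ → Set where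
  []  : Runs []
  run : ∀ a r {ws} → Runs ws → DiffersFromHead a ws → Runs (a ∷ replicate r a ++ ws)

runs : ∀ w → Runs w
runs []       = []
runs (a ∷ ws) with runs ws
... | []            = run a 0 [] tt
... | run c r R c≢d with a ≡ᵇ c in a≡ᵇc
...   | false = run a 0 (run c r R c≢d) a≡ᵇc
...   | true with refl ← ≡ᵇ⇒≡ a c (Equivalence.from T-≡ a≡ᵇc) = run a (suc r) R c≢d

module _ {A : Set} where

  reverseRuns : ∀ {w} → Runs w → List A → List A
  reverseRuns []            σ = σ
  reverseRuns (run a r R _) σ = reverse (take (suc r) σ) ++ reverseRuns R (drop (suc r) σ)

  reverseRuns-↭ : ∀ {w} (R : Runs w) σ → reverseRuns R σ ↭ σ
  reverseRuns-↭ []            σ = ↭-refl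
  reverseRuns-↭ (run a r R a≢) σ = subst (reverseRuns (run a r R a≢) σ ↭_) (take++drop≡id (suc r) σ)
    (++⁺ (↭-reverse (take (suc r) σ)) (reverseRuns-↭ R (drop (suc r) σ)))

  reverseRuns-++ : ∀ a r {ws} (R : Runs ws) a≢ {xs ys : List A} → length xs ≡ suc r →
    reverseRuns (run a r R a≢) (xs ++ ys) ≡ reverse xs ++ reverseRuns R ys
  reverseRuns-++ a r R a≢ {xs} {ys} |xs| rewrite sym |xs| =
    cong₂ (λ t d → reverse t ++ reverseRuns R d) (take-length-++ xs ys) (drop-length-++ xs ys)

Σ-words-reverseRuns : ∀ n {w} (R : Runs w) g →
  Σ-words n (length w) (g ∘ reverseRuns R) ≡ Σ-words n (length w) g
Σ-words-reverseRuns n []                  g = refl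
Σ-words-reverseRuns n (run a r {ws} R a≢) g rewrite length-replicate-++ r a ws = begin
  Σ-words n (suc r + m) (g ∘ reverseRuns (run a r R a≢))
    ≡⟨ Σ-words-++ n (suc r) m _ ⟩
  Σ-words n m (λ ys → Σ-words n (suc r) (λ xs → g (reverseRuns (run a r R a≢) (xs ++ ys))))
    ≡⟨ Σ-words-cong n m (λ {ys} _ → reverseBlock ys) ⟩
  Σ-words n m (λ ys → Σ-words n (suc r) (λ xs → g (xs ++ reverseRuns R ys)))
    ≡⟨ Σ-words-reverseRuns n R (λ ys → Σ-words n (suc r) (λ xs → g (xs ++ ys))) ⟩
  Σ-words n m (λ ys → Σ-words n (suc r) (λ xs → g (xs ++ ys)))
    ≡⟨ sym (Σ-words-++ n (suc r) m g) ⟩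
  Σ-words n (suc r + m) g ∎
  where
  m = length ws
  reverseBlock : ∀ ys → Σ-words n (suc r) (λ xs → g (reverseRuns (run a r R a≢) (xs ++ ys)))
                      ≡ Σ-words n (suc r) (λ xs → g (xs ++ reverseRuns R ys))
  reverseBlock ys = begin
    Σ-words n (suc r) (λ xs → g (reverseRuns (run a r R a≢) (xs ++ ys)))
      ≡⟨ Σ-words-cong n (suc r) (λ {xs} |xs| → cong g (reverseRuns-++ a r R a≢ {xs} |xs|)) ⟩
    Σ-words n (suc r) (λ xs → g (reverse xs ++ reverseRuns R ys))
      ≡⟨ Σ-words-reverse n (suc r) (λ xs → g (xs ++ reverseRuns R ys)) ⟩
    Σ-words n (suc r) (λ xs → g (xs ++ reverseRuns R ys)) ∎

isUnique : ∀ {n} → List (Fin n) → Bool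
isUnique σ = does (UniqueDec.unique? FinP._≟_ σ)

isUnique-↭ : ∀ {n} {σ σ′ : List (Fin n)} → σ ↭ σ′ → isUnique σ ≡ isUnique σ′
isUnique-↭ {n} {σ} {σ′} σ↭σ′ = does-⇔ (mk⇔ (Unique-resp-↭ (↭⇒↭ₛ σ↭σ′)) (Unique-resp-↭ (↭⇒↭ₛ (↭-sym σ↭σ′))))
                                      (unique? σ) (unique? σ′)
  where
  open PermutationSetoid (setoid (Fin n)) using (Unique-resp-↭)
  open UniqueDec FinP._≟_ using (unique?)

sum-listings-reverseRuns : ∀ {n w} (R : Runs w) → length w ≡ n → (g : List (Fin n) → ℕ) →
  sum (map (g ∘ reverseRuns R) (listings n)) ≡ sum (map g (listings n))
sum-listings-reverseRuns {w = w} R refl g = begin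
  sum (map (g ∘ reverseRuns R) (listings n))
    ≡⟨ sum-map-filter (UniqueDec.unique? FinP._≟_) _ (allLists n n) ⟩
  Σ-words n n (λ σ → if isUnique σ then g (reverseRuns R σ) else 0)
    ≡⟨ Σ-words-cong n n (λ {σ} _ → cong (if_then g (reverseRuns R σ) else 0) (sym (isUnique-↭ (reverseRuns-↭ R σ)))) ⟩
  Σ-words n n (onUnique ∘ reverseRuns R)
    ≡⟨ Σ-words-reverseRuns n R onUnique ⟩
  Σ-words n n onUnique
    ≡⟨ sym (sum-map-filter (UniqueDec.unique? FinP._≟_) g (allLists n n)) ⟩
  sum (map g (listings n)) ∎
  where
  n = length w
  onUnique : List (Fin n) → ℕ
  onUnique σ = if isUnique σ then g σ else 0

module _ {n : ℕ} (Y : Digraph n) where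

  noEdge : List (Fin n) → Bool
  noEdge (x ∷ y ∷ σ) = not (E Y x y) ∧ noEdge (y ∷ σ)
  noEdge _           = true

  noEdgeWithinRuns : List ℕ → List (Fin n) → Bool
  noEdgeWithinRuns (a ∷ c ∷ w) (x ∷ y ∷ σ) = (not (E Y x y) ∨ not (a ≡ᵇ c)) ∧ noEdgeWithinRuns (c ∷ w) (y ∷ σ)
  noEdgeWithinRuns _           _           = true

≤⇒<ᵇ≡not≡ᵇ : ∀ {a c} → a ≤ c → (a <ᵇ c) ≡ not (a ≡ᵇ c)
≤⇒<ᵇ≡not≡ᵇ {zero}  {zero}  _          = refl
≤⇒<ᵇ≡not≡ᵇ {zero}  {suc c} _          = refl
≤⇒<ᵇ≡not≡ᵇ {suc a} {suc c} (s≤s a≤c) = ≤⇒<ᵇ≡not≡ᵇ a≤c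

compatible-XDes : ∀ {n} (Y : Digraph n) {w σ} → Linked _≤_ w → length σ ≡ length w →
  compatible (XDes Y σ) w ≡ noEdgeWithinRuns Y w σ
compatible-XDes Y {[]}        {[]}        _            _   = refl
compatible-XDes Y {a ∷ []}    {x ∷ []}    _            _   = refl
compatible-XDes Y {a ∷ c ∷ w} {x ∷ y ∷ σ} (a≤c ∷ c∷w↑) |σ|
  rewrite Equivalence.to T-≡ (≤⇒≤ᵇ a≤c) | ≤⇒<ᵇ≡not≡ᵇ a≤c
        | compatible-XDes Y {c ∷ w} {y ∷ σ} c∷w↑ (suc-injective |σ|) = refl

module _ {n : ℕ} where

  noEdge-ʳ++ : ∀ (X : Digraph n) x σ acc →
    noEdge X ((x ∷ σ) ʳ++ acc) ≡ noEdge (op X) (x ∷ σ) ∧ noEdge X (x ∷ acc)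
  noEdge-ʳ++ X x []      acc = refl
  noEdge-ʳ++ X x (y ∷ σ) acc = begin
    noEdge X ((y ∷ σ) ʳ++ (x ∷ acc))
      ≡⟨ noEdge-ʳ++ X y σ (x ∷ acc) ⟩
    noEdge (op X) (y ∷ σ) ∧ (not (E X y x) ∧ noEdge X (x ∷ acc))
      ≡⟨ sym (∧-assoc (noEdge (op X) (y ∷ σ)) _ _) ⟩
    (noEdge (op X) (y ∷ σ) ∧ not (E X y x)) ∧ noEdge X (x ∷ acc)
      ≡⟨ cong (_∧ noEdge X (x ∷ acc)) (∧-comm (noEdge (op X) (y ∷ σ)) _) ⟩
    (not (E X y x) ∧ noEdge (op X) (y ∷ σ)) ∧ noEdge X (x ∷ acc) ∎

  noEdge-op : ∀ (X : Digraph n) σ → noEdge (op X) σ ≡ noEdge X (reverse σ)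
  noEdge-op X []      = refl
  noEdge-op X (x ∷ σ) = sym (trans (noEdge-ʳ++ X x σ []) (∧-identityʳ _))

  -- The run of a is maximal, so the boundary to the next run imposes no condition.
  noEdgeWithinRuns-run : ∀ (Y : Digraph n) a r {ws} → DiffersFromHead a ws → ∀ t σ → length t ≡ suc r →
    noEdgeWithinRuns Y (a ∷ replicate r a ++ ws) (t ++ σ) ≡ noEdge Y t ∧ noEdgeWithinRuns Y ws σ
  noEdgeWithinRuns-run Y a zero    {[]}         _   (x ∷ [])    σ       _ = refl
  noEdgeWithinRuns-run Y a zero    {c ∷ []}     _   (x ∷ [])    []      _ = refl
  noEdgeWithinRuns-run Y a zero    {c ∷ d ∷ ws} _   (x ∷ [])    []      _ = refl
  noEdgeWithinRuns-run Y a zero    {c ∷ ws}     a≢c (x ∷ [])    (y ∷ σ) _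
    rewrite a≢c | ∨-zeroʳ (not (E Y x y)) = refl
  noEdgeWithinRuns-run Y a (suc r) {ws}         a≢  (x ∷ y ∷ t) σ       |t|
    rewrite Equivalence.to T-≡ (≡⇒≡ᵇ a a refl) | ∨-identityʳ (not (E Y x y))
          | noEdgeWithinRuns-run Y a r a≢ (y ∷ t) σ (suc-injective |t|)
          = sym (∧-assoc (not (E Y x y)) (noEdge Y (y ∷ t)) _)

  noEdgeWithinRuns-op : ∀ (X : Digraph n) {w} (R : Runs w) σ → length σ ≡ length w →
    noEdgeWithinRuns (op X) w σ ≡ noEdgeWithinRuns X w (reverseRuns R σ)
  noEdgeWithinRuns-op X []                  σ _   = refl
  noEdgeWithinRuns-op X (run a r {ws} R a≢) σ |σ| = begin
    noEdgeWithinRuns (op X) w σ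
      ≡⟨ cong (noEdgeWithinRuns (op X) w) (sym (take++drop≡id (suc r) σ)) ⟩
    noEdgeWithinRuns (op X) w (t ++ σ′)
      ≡⟨ noEdgeWithinRuns-run (op X) a r a≢ t σ′ |t| ⟩
    noEdge (op X) t ∧ noEdgeWithinRuns (op X) ws σ′
      ≡⟨ cong₂ _∧_ (noEdge-op X t) (noEdgeWithinRuns-op X R σ′ |σ′|) ⟩
    noEdge X (reverse t) ∧ noEdgeWithinRuns X ws (reverseRuns R σ′)
      ≡⟨ sym (noEdgeWithinRuns-run X a r a≢ (reverse t) _ (trans (length-reverse t) |t|)) ⟩
    noEdgeWithinRuns X w (reverse t ++ reverseRuns R σ′) ∎
    where
    w = a ∷ replicate r a ++ ws
    t = take (suc r) σ
    σ′ = drop (suc r) σ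
    |t|,|σ′| : length t ≡ suc r × length σ′ ≡ length ws
    |t|,|σ′| = length-take-drop (suc r) σ (trans |σ| (cong suc (length-replicate-++ r a ws)))
    |t| = proj₁ |t|,|σ′|
    |σ′| = proj₂ |t|,|σ′|

compatible-XDes-op : ∀ {n} (X : Digraph n) {w} (R : Runs w) → Linked _≤_ w → ∀ {σ} → length σ ≡ length w →
  compatible (XDes (op X) σ) w ≡ compatible (XDes X (reverseRuns R σ)) w
compatible-XDes-op X {w} R w↑ {σ} |σ| = begin
  compatible (XDes (op X) σ) w              ≡⟨ compatible-XDes (op X) w↑ |σ| ⟩
  noEdgeWithinRuns (op X) w σ               ≡⟨ noEdgeWithinRuns-op X R σ |σ| ⟩
  noEdgeWithinRuns X w (reverseRuns R σ)    ≡⟨ sym (compatible-XDes X w↑ (trans (↭-length (reverseRuns-↭ R σ)) |σ|)) ⟩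
  compatible (XDes X (reverseRuns R σ)) w   ∎

mainTheorem6 : (n : ℕ) (X : Digraph n) (w : List ℕ) → Linked _≤_ w →
    Ucoef (op X) w ≡ Ucoef X w
mainTheorem6 n X w w↑ with length w ≡ᵇ n in |w|≡ᵇn
-- Fcoef n I w vanishes for every I when length w ≠ n.
... | false = refl
... | true  = begin
  sum (map (coefficient (op X)) (listings n))
    ≡⟨ cong sum (map-cong-local (All.map coefficient-op (listings-length n))) ⟩
  sum (map (coefficient X ∘ reverseRuns R) (listings n))
    ≡⟨ sum-listings-reverseRuns R |w|≡n (coefficient X) ⟩
  sum (map (coefficient X) (listings n)) ∎
  where
  R = runs w
  |w|≡n : length w ≡ n
  |w|≡n = ≡ᵇ⇒≡ (length w) n (Equivalence.from T-≡ |w|≡ᵇn)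
  coefficient : Digraph n → List (Fin n) → ℕ
  coefficient Y σ = if compatible (XDes Y σ) w then 1 else 0
  coefficient-op : ∀ {σ} → length σ ≡ n → coefficient (op X) σ ≡ coefficient X (reverseRuns R σ)
  coefficient-op |σ| = cong (if_then 1 else 0) (compatible-XDes-op X R w↑ (trans |σ| (sym |w|≡n)))
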